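{- Let $\alpha$ be a constant with $\frac38<\alpha<\frac12$. For a uniformly random Boolean function $f\colon\{0,1\}^n\to\{0,1\}$, with probability $1-o(1)$ (as $n\to\infty$), $f$ is $\alpha$-balanced and $\mathsf{L}_{3/4}(f)\ge c\,\frac{2^n}{\log n}$, where $c>0$ is a constant independent of $n$.
   Context: $\log$ is the binary logarithm. $f$ is $\alpha$-balanced if $\alpha 2^n\le|f^{ -1}(0)|,|f^{ -1}(1)|\le(1-\alpha)2^n$. A de Morgan formula is a binary tree with leaves labeled by variables or their negations and internal nodes labeled $\lor$ or $\land$; its size is its number of leaves. $\mathsf{L}_{3/4}(f)$ is the smallest size of a de Morgan formula $F$ with $\Pr_{x\in\{0,1\}^n}[F(x)=f(x)]\ge\frac34$.
   Formalization: The constant α ranges only over the rationals satisfying $\frac38<\alpha<\frac12$. -}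

module Defs where

open import Data.Nat using (ℕ; zero; suc; _+_; _*_; _∸_; _^_; _≤_; _<_)
open import Data.Bool using (Bool; true; false; not; _∧_; _∨_) renaming (_≟_ to _≟ᵇ_)
open import Data.Fin using (Fin)
open import Data.Vec using (Vec; []; _∷_; lookup)
open import Data.List using (List; []; _∷_; _++_; map; concatMap; length; filter)
open import Relation.Binary.PropositionalEquality using (_≡_)

-- Inputs: {0,1}^n as Vec Bool n (false = 0, true = 1).
Input : ℕ → Set
Input n = Vec Bool n

allInputs : (n : ℕ) → List (Input n)
allInputs zero    = [] ∷ []
allInputs (suc n) = map (false ∷_) (allInputs n) ++ map (true ∷_) (allInputs n)

BoolFun : ℕ → Set
BoolFun n = Input n → Bool

-- All 2^(2^n) Boolean functions on n variables, each (extensionally) exactly once.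
-- A function on n+1 variables is determined by its two restrictions x₀ = 0 and x₀ = 1.
glue : {n : ℕ} → BoolFun n → BoolFun n → BoolFun (suc n)
glue g h (false ∷ xs) = g xs
glue g h (true  ∷ xs) = h xs

allFuns : (n : ℕ) → List (BoolFun n)
allFuns zero    = (λ _ → false) ∷ (λ _ → true) ∷ []
allFuns (suc n) = concatMap (λ g → map (glue g) (allFuns n)) (allFuns n)

preimageSize : {n : ℕ} → BoolFun n → Bool → ℕ
preimageSize {n} f b = length (filter (λ x → f x ≟ᵇ b) (allInputs n))

-- f is (a/b)-balanced:  (a/b) 2^n ≤ |f⁻¹(c)| ≤ (1 - a/b) 2^n  for c = 0,1
-- (multiplied through by b).
Balanced : (a b : ℕ) → {n : ℕ} → BoolFun n → Set
Balanced a b {n} f =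
  (a * 2 ^ n ≤ b * preimageSize f false) × (b * preimageSize f false ≤ (b ∸ a) * 2 ^ n) ×
  (a * 2 ^ n ≤ b * preimageSize f true)  × (b * preimageSize f true  ≤ (b ∸ a) * 2 ^ n)
  where open import Data.Product using (_×_)

-- De Morgan formulas over variables x₀..x_{n-1}.
-- lit i true = x_i, lit i false = ¬x_i.
data Formula (n : ℕ) : Set where
  lit  : Fin n → Bool → Formula n
  and  : Formula n → Formula n → Formula n
  or   : Formula n → Formula n → Formula n

size : {n : ℕ} → Formula n → ℕ
size (lit _ _) = 1
size (and F G) = size F + size G
size (or F G)  = size F + size G

eval : {n : ℕ} → Formula n → Input n → Bool
eval (lit i true)  x = lookup x i
eval (lit i false) x = not (lookup x i)
eval (and F G) x = eval F x ∧ eval G x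
eval (or F G)  x = eval F x ∨ eval G x

agreement : {n : ℕ} → Formula n → BoolFun n → ℕ
agreement {n} F f = length (filter (λ x → eval F x ≟ᵇ f x) (allInputs n))

-- "L_{3/4}(f) ≥ (p/q) · 2^n / log₂ n" :
-- every formula F with Pr_x[F(x)=f(x)] ≥ 3/4 has size F ≥ (p/q) 2^n / log₂ n,
-- i.e. q · size F · log₂ n ≥ p · 2^n, i.e. (exactly, for n ≥ 2, exponentiating)
-- n^(q · size F) ≥ 2^(p · 2^n).
L34-LowerBound : (p q : ℕ) → {n : ℕ} → BoolFun n → Set
L34-LowerBound p q {n} f =
  (F : Formula n) → 3 * 2 ^ n ≤ 4 * agreement F f → 2 ^ (p * 2 ^ n) ≤ n ^ (q * size F)

-- A uniformly random f : {0,1}ⁿ → {0,1} is balanced by Chebyshev's inequality: for a fixed g, the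
-- number of inputs on which f agrees with g has mean 2ⁿ/2 and variance 2ⁿ/4.  These moments, like the
-- generating function ∑_f 3^agreements = 4^(2ⁿ), follow by splitting f along its first variable.
-- Hardness is counting: written in postfix over 2n+3 letters and padded to length 2s, there are at most
-- (2n+3)^(2s) ≤ n^(4s) formulas of size ≤ s, and by Markov's inequality applied to 3^agreements a fixed
-- formula agrees with f on 3/4 of the inputs for only a fraction (16/27)^(2ⁿ/4) of all f.  Choosing s with
-- n^(4s) ≤ 2^(2ⁿ/16) < n^(4(s+1)) makes these f negligible, and every other f needs formulas of size > s,
-- so that 2^(2ⁿ) ≤ n^(64 · size).

module Submission where

open import Defs
open import Data.Nat using (ℕ; suc; _*_; _≤_; _<_)
open import Data.Product using (Σ; _×_; ∃-syntax)
open import Data.List using (length; lookup)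
open import Data.Fin.Subset using (Subset; _∈_; ∣_∣)

open import Level using (0ℓ)
open import Function using (_∘_)
open import Data.Nat using (zero; _+_; _∸_; _^_; z≤n; s≤s; z<s; _<?_; _≤?_; ∣_-_∣; NonZero; >-nonZero)
open import Data.Nat.Properties
open import Data.Nat.Tactic.RingSolver using (solve-∀)
open import Data.Bool using (Bool; true; false) renaming (_≟_ to _≟ᵇ_)
open import Data.Unit using (tt)
open import Data.Empty using (⊥-elim)
open import Data.Product using (_,_; proj₁; proj₂)
open import Data.Sum using (_⊎_; inj₁; inj₂)
open import Data.Maybe using (Maybe; just)
import Data.Maybe.Relation.Unary.Any as MaybeAny
open import Data.Fin using (Fin)
open import Data.Vec using ([]; _∷_)
import Data.Vec as Vec
import Data.Vec.Properties as Vec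
open import Data.List using (List; []; _∷_; _++_; [_]; map; concatMap; filter; allFin; replicate; head; mapMaybe)
open import Data.List.Properties using (length-++; length-map; filter-++; filter-≐; ++-assoc; ++-identityʳ; length-replicate; length-mapMaybe; length-tabulate)
open import Data.List.Relation.Unary.All using (All; []; _∷_)
import Data.List.Relation.Unary.All as All
open import Data.List.Relation.Unary.Any using (Any; here; there; any?)
import Data.List.Relation.Unary.Any as Any
import Data.List.Relation.Unary.Any.Properties as Any
open import Data.List.Membership.Propositional using (lose) renaming (_∈_ to _∈ₗ_)
open import Data.List.Membership.Propositional.Properties using (∈-map⁺; ∈-concat⁺′; ∈-allFin)
open import Relation.Binary.PropositionalEquality using (_≡_; refl; sym; trans; cong; cong₂; subst; subst₂; module ≡-Reasoning)
open import Relation.Nullary using (yes; no; ¬_; does; proof)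
open import Relation.Nullary.Reflects using (Reflects; invert)
open import Relation.Nullary.Decidable using (¬?; _⊎-dec_; toWitness)
open import Relation.Unary using (Pred; Decidable)

private
  variable
    A B : Set

2^suc : (n : ℕ) → 2 ^ suc n ≡ 2 ^ n + 2 ^ n
2^suc n = cong (2 ^ n +_) (+-identityʳ (2 ^ n))

n<2^n : ∀ n → n < 2 ^ n
n<2^n zero    = z<s
n<2^n (suc n) = subst₂ _<_ (+-identityʳ (suc n)) (sym (2^suc n)) (+-mono-≤-< (n<2^n n) (m^n>0 2 n))

^-distribʳ-* : ∀ x y k → (x * y) ^ k ≡ x ^ k * y ^ k
^-distribʳ-* x y zero    = refl
^-distribʳ-* x y (suc k) = trans (cong (x * y *_) (^-distribʳ-* x y k)) (interchange x y (x ^ k) (y ^ k))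
  where
  interchange : ∀ x y p q → x * y * (p * q) ≡ x * p * (y * q)
  interchange = solve-∀

∃-power-bracketing : ∀ B y → 1 < B → 0 < y → ∃[ s ] (B ^ s ≤ y × y < B ^ suc s)
∃-power-bracketing B (suc zero)    1<B _ = 0 , ≤-refl , subst (1 <_) (sym (*-identityʳ B)) 1<B
∃-power-bracketing B (suc (suc y)) 1<B _ with ∃-power-bracketing B (suc y) 1<B z<s
... | s , lower , upper with m≤n⇒m<n∨m≡n upper
...   | inj₁ upper′ = s , m≤n⇒m≤1+n lower , upper′
...   | inj₂ y≡Bˢ⁺¹ = suc s , ≤-reflexive (sym y≡Bˢ⁺¹) ,
                      subst (suc (suc y) <_) (trans (*-comm (suc (suc y)) B) (cong (B *_) y≡Bˢ⁺¹))
                            (m<m*n (suc (suc y)) B 1<B)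

∣m-n∣²+2mn : ∀ m n → ∣ m - n ∣ * ∣ m - n ∣ + 2 * m * n ≡ m * m + n * n
∣m-n∣²+2mn zero    n       = +-comm (n * n) 0
∣m-n∣²+2mn (suc m) zero    = right-zero (suc m)
  where
  right-zero : ∀ m → m * m + 2 * m * 0 ≡ m * m + 0 * 0
  right-zero = solve-∀
∣m-n∣²+2mn (suc m) (suc n) = begin
  d * d + 2 * suc m * suc n             ≡⟨ expand d m n ⟩
  (d * d + 2 * m * n) + 2 * suc (m + n) ≡⟨ cong (_+ 2 * suc (m + n)) (∣m-n∣²+2mn m n) ⟩
  (m * m + n * n) + 2 * suc (m + n)     ≡⟨ square-suc m n ⟩
  suc m * suc m + suc n * suc n         ∎
  where
  open ≡-Reasoning
  d : ℕ
  d = ∣ m - n ∣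
  expand : ∀ d m n → d * d + 2 * suc m * suc n ≡ (d * d + 2 * m * n) + 2 * suc (m + n)
  expand = solve-∀
  square-suc : ∀ m n → (m * m + n * n) + 2 * suc (m + n) ≡ suc m * suc m + suc n * suc n
  square-suc = solve-∀

2a<b⇒1+b≤2[b-a] : ∀ {a b} → 2 * a < b → suc b ≤ 2 * (b ∸ a)
2a<b⇒1+b≤2[b-a] {a} {b} 2a<b = +-cancelʳ-≤ (2 * a) (suc b) (2 * (b ∸ a)) (begin
  suc b + 2 * a       ≡⟨ +-suc b (2 * a) ⟨
  b + suc (2 * a)     ≤⟨ +-monoʳ-≤ b 2a<b ⟩
  b + b               ≡⟨ cong (b +_) (+-identityʳ b) ⟨
  2 * b               ≡⟨ cong (2 *_) (m∸n+n≡m a≤b) ⟨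
  2 * (b ∸ a + a)     ≡⟨ *-distribˡ-+ 2 (b ∸ a) a ⟩
  2 * (b ∸ a) + 2 * a ∎)
  where
  open ≤-Reasoning
  a≤b : a ≤ b
  a≤b = ≤-trans (m≤m+n a (a + 0)) (<⇒≤ 2a<b)

small-deviation⇒between : ∀ a b m x → 2 * a < b → b * ∣ 2 * x - m ∣ ≤ m →
                          a * m ≤ b * x × b * x ≤ (b ∸ a) * m
small-deviation⇒between a b m x 2a<b small = lower , upper
  where
  open ≤-Reasoning
  d : ℕ
  d = ∣ 2 * x - m ∣
  b[2x]≡2[bx] : ∀ b x → b * (2 * x) ≡ 2 * (b * x)
  b[2x]≡2[bx] = solve-∀
  lower : a * m ≤ b * x
  lower = *-cancelˡ-≤ 2 (+-cancelʳ-≤ m (2 * (a * m)) (2 * (b * x)) (begin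
    2 * (a * m) + m    ≡⟨ +-comm (2 * (a * m)) m ⟩
    m + 2 * (a * m)    ≡⟨ cong (m +_) (*-assoc 2 a m) ⟨
    suc (2 * a) * m    ≤⟨ *-monoˡ-≤ m 2a<b ⟩
    b * m              ≤⟨ *-monoʳ-≤ b (m≤n+∣n-m∣ m (2 * x)) ⟩
    b * (2 * x + d)    ≡⟨ *-distribˡ-+ b (2 * x) d ⟩
    b * (2 * x) + b * d ≤⟨ +-monoʳ-≤ (b * (2 * x)) small ⟩
    b * (2 * x) + m    ≡⟨ cong (_+ m) (b[2x]≡2[bx] b x) ⟩
    2 * (b * x) + m    ∎))
  upper : b * x ≤ (b ∸ a) * m
  upper = *-cancelˡ-≤ 2 (begin
    2 * (b * x)        ≡⟨ b[2x]≡2[bx] b x ⟨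
    b * (2 * x)        ≤⟨ *-monoʳ-≤ b (m≤n+∣m-n∣ (2 * x) m) ⟩
    b * (m + d)        ≡⟨ *-distribˡ-+ b m d ⟩
    b * m + b * d      ≤⟨ +-monoʳ-≤ (b * m) small ⟩
    b * m + m          ≡⟨ +-comm (b * m) m ⟩
    suc b * m          ≤⟨ *-monoˡ-≤ m (2a<b⇒1+b≤2[b-a] {a} 2a<b) ⟩
    2 * (b ∸ a) * m    ≡⟨ *-assoc 2 (b ∸ a) m ⟩
    2 * ((b ∸ a) * m)  ∎)

∑ : {A : Set} → List A → (A → ℕ) → ℕ
∑ []       w = 0
∑ (x ∷ xs) w = w x + ∑ xs w

syntax ∑ xs (λ x → e) = ∑[ x ← xs ] e

∑-++ : (xs ys : List A) (w : A → ℕ) → ∑ (xs ++ ys) w ≡ ∑ xs w + ∑ ys w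
∑-++ []       ys w = refl
∑-++ (x ∷ xs) ys w = trans (cong (w x +_) (∑-++ xs ys w)) (sym (+-assoc (w x) _ _))

∑-cong : {v w : A → ℕ} → (∀ x → v x ≡ w x) → (xs : List A) → ∑ xs v ≡ ∑ xs w
∑-cong v≡w []       = refl
∑-cong v≡w (x ∷ xs) = cong₂ _+_ (v≡w x) (∑-cong v≡w xs)

∑-mono : {v w : A → ℕ} → (∀ x → v x ≤ w x) → (xs : List A) → ∑ xs v ≤ ∑ xs w
∑-mono v≤w []       = ≤-refl
∑-mono v≤w (x ∷ xs) = +-mono-≤ (v≤w x) (∑-mono v≤w xs)

∑-+ : (v w : A → ℕ) (xs : List A) → ∑[ x ← xs ] (v x + w x) ≡ ∑ xs v + ∑ xs w
∑-+ v w []       = refl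
∑-+ v w (x ∷ xs) = trans (cong (v x + w x +_) (∑-+ v w xs)) (interchange (v x) (w x) _ _)
  where
  interchange : ∀ a b c d → a + b + (c + d) ≡ a + c + (b + d)
  interchange = solve-∀

∑-*ˡ : (c : ℕ) (w : A → ℕ) (xs : List A) → ∑[ x ← xs ] (c * w x) ≡ c * ∑ xs w
∑-*ˡ c w []       = sym (*-zeroʳ c)
∑-*ˡ c w (x ∷ xs) = trans (cong (c * w x +_) (∑-*ˡ c w xs)) (sym (*-distribˡ-+ c (w x) _))

∑-*ʳ : (c : ℕ) (w : A → ℕ) (xs : List A) → ∑[ x ← xs ] (w x * c) ≡ ∑ xs w * c
∑-*ʳ c w xs = trans (∑-cong (λ x → *-comm (w x) c) xs) (trans (∑-*ˡ c w xs) (*-comm c _))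

∑-const : (c : ℕ) (xs : List A) → ∑ xs (λ _ → c) ≡ length xs * c
∑-const c []       = refl
∑-const c (x ∷ xs) = cong (c +_) (∑-const c xs)

∑-concatMap : (f : A → List B) (w : B → ℕ) (xs : List A) →
              ∑ (concatMap f xs) w ≡ ∑[ x ← xs ] (∑ (f x) w)
∑-concatMap f w []       = refl
∑-concatMap f w (x ∷ xs) = trans (∑-++ (f x) (concatMap f xs) w) (cong (∑ (f x) w +_) (∑-concatMap f w xs))

∑-map : (f : A → B) (w : B → ℕ) (xs : List A) → ∑ (map f xs) w ≡ ∑[ x ← xs ] (w (f x))
∑-map f w []       = refl
∑-map f w (x ∷ xs) = cong (w (f x) +_) (∑-map f w xs)

length-concatMap : (f : A → List B) (xs : List A) →
                   length (concatMap f xs) ≡ ∑[ x ← xs ] (length (f x))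
length-concatMap f []       = refl
length-concatMap f (x ∷ xs) = trans (length-++ (f x)) (cong (length (f x) +_) (length-concatMap f xs))

module _ (L : List A) (M : List B) where

  ∑∑-+ : (v : A → ℕ) (w : B → ℕ) →
         ∑[ x ← L ] ∑[ y ← M ] (v x + w y) ≡ length M * ∑ L v + length L * ∑ M w
  ∑∑-+ v w = begin
    ∑[ x ← L ] ∑[ y ← M ] (v x + w y)   ≡⟨ ∑-cong (λ x → ∑-+ (λ _ → v x) w M) L ⟩
    ∑[ x ← L ] (∑ M (λ _ → v x) + ∑ M w) ≡⟨ ∑-+ (λ x → ∑ M (λ _ → v x)) (λ _ → ∑ M w) L ⟩
    ∑[ x ← L ] (∑ M (λ _ → v x)) + ∑ L (λ _ → ∑ M w)
      ≡⟨ cong₂ _+_ (trans (∑-cong (λ x → ∑-const (v x) M) L) (∑-*ˡ (length M) v L)) (∑-const (∑ M w) L) ⟩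
    length M * ∑ L v + length L * ∑ M w ∎
    where open ≡-Reasoning

  ∑∑-* : (v : A → ℕ) (w : B → ℕ) → ∑[ x ← L ] ∑[ y ← M ] (v x * w y) ≡ ∑ L v * ∑ M w
  ∑∑-* v w = trans (∑-cong (λ x → ∑-*ˡ (v x) w M) L) (∑-*ʳ (∑ M w) v L)

  ∑∑-+² : (v : A → ℕ) (w : B → ℕ) →
          ∑[ x ← L ] ∑[ y ← M ] ((v x + w y) * (v x + w y)) ≡
          (length M * ∑[ x ← L ] (v x * v x) + length L * ∑[ y ← M ] (w y * w y)) + 2 * (∑ L v * ∑ M w)
  ∑∑-+² v w = begin
    ∑[ x ← L ] ∑[ y ← M ] ((v x + w y) * (v x + w y))
      ≡⟨ ∑-cong (λ x → ∑-cong (λ y → square-+ (v x) (w y)) M) L ⟩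
    ∑[ x ← L ] ∑[ y ← M ] ((v x * v x + w y * w y) + 2 * (v x * w y))
      ≡⟨ ∑-cong (λ x → ∑-+ (λ y → v x * v x + w y * w y) (λ y → 2 * (v x * w y)) M) L ⟩
    ∑[ x ← L ] (∑[ y ← M ] (v x * v x + w y * w y) + ∑[ y ← M ] (2 * (v x * w y)))
      ≡⟨ ∑-+ _ _ L ⟩
    ∑[ x ← L ] ∑[ y ← M ] (v x * v x + w y * w y) + ∑[ x ← L ] ∑[ y ← M ] (2 * (v x * w y))
      ≡⟨ cong₂ _+_ (∑∑-+ (λ x → v x * v x) (λ y → w y * w y))
                   (trans (∑-cong (λ x → ∑-*ˡ 2 (λ y → v x * w y) M) L) (∑-*ˡ 2 (λ x → ∑[ y ← M ] (v x * w y)) L)) ⟩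
    squares + 2 * ∑[ x ← L ] ∑[ y ← M ] (v x * w y)
      ≡⟨ cong (λ s → squares + 2 * s) (∑∑-* v w) ⟩
    squares + 2 * (∑ L v * ∑ M w) ∎
    where
    open ≡-Reasoning
    square-+ : ∀ p q → (p + q) * (p + q) ≡ (p * p + q * q) + 2 * (p * q)
    square-+ = solve-∀
    squares : ℕ
    squares = length M * ∑[ x ← L ] (v x * v x) + length L * ∑[ y ← M ] (w y * w y)

count : {P : Pred A 0ℓ} → Decidable P → List A → ℕ
count P? xs = length (filter P? xs)

module _ {P : Pred A 0ℓ} (P? : Decidable P) where

  count-++ : (xs ys : List A) → count P? (xs ++ ys) ≡ count P? xs + count P? ys
  count-++ xs ys = trans (cong length (filter-++ P? xs ys)) (length-++ (filter P? xs))

  count-map : (f : B → A) (xs : List B) → count P? (map f xs) ≡ count (P? ∘ f) xs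
  count-map f []       = refl
  count-map f (x ∷ xs) with P? (f x)
  ... | yes _ = cong suc (count-map f xs)
  ... | no  _ = count-map f xs

  count-complement : (xs : List A) → count P? xs + count (¬? ∘ P?) xs ≡ length xs
  count-complement []       = refl
  count-complement (x ∷ xs) with P? x
  ... | yes _ = cong suc (count-complement xs)
  ... | no  _ = trans (+-suc _ _) (cong suc (count-complement xs))

  markov : (w : A → ℕ) (c : ℕ) → (∀ x → P x → c ≤ w x) → (xs : List A) → count P? xs * c ≤ ∑ xs w
  markov w c P⇒c≤w []       = z≤n
  markov w c P⇒c≤w (x ∷ xs) with P? x
  ... | yes px = +-mono-≤ (P⇒c≤w x px) (markov w c P⇒c≤w xs)
  ... | no  _  = ≤-trans (markov w c P⇒c≤w xs) (m≤n+m _ (w x))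

  module _ {Q : Pred A 0ℓ} (Q? : Decidable Q) where

    count-mono : (∀ x → P x → Q x) → (xs : List A) → count P? xs ≤ count Q? xs
    count-mono P⇒Q []       = z≤n
    count-mono P⇒Q (x ∷ xs) with P? x | Q? x
    ... | yes px | no ¬qx = ⊥-elim (¬qx (P⇒Q x px))
    ... | yes _  | yes _  = s≤s (count-mono P⇒Q xs)
    ... | no  _  | yes _  = m≤n⇒m≤1+n (count-mono P⇒Q xs)
    ... | no  _  | no  _  = count-mono P⇒Q xs

    count-⊎ : (xs : List A) → count (λ x → P? x ⊎-dec Q? x) xs ≤ count P? xs + count Q? xs
    count-⊎ []       = z≤n
    count-⊎ (x ∷ xs) with P? x | Q? x
    ... | yes _ | yes _ = s≤s (≤-trans (count-⊎ xs) (+-monoʳ-≤ (count P? xs) (n≤1+n _)))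
    ... | yes _ | no  _ = s≤s (count-⊎ xs)
    ... | no  _ | yes _ = ≤-trans (s≤s (count-⊎ xs)) (≤-reflexive (sym (+-suc _ _)))
    ... | no  _ | no  _ = count-⊎ xs

count-any : {P : B → Pred A 0ℓ} (P? : ∀ y → Decidable (P y)) (ys : List B) (xs : List A) →
            count (λ x → any? (λ y → P? y x) ys) xs ≤ ∑[ y ← ys ] (count (P? y) xs)
count-any P? []       xs = ≤-reflexive (count-none xs)
  where
  count-none : ∀ xs → count (λ x → any? (λ y → P? y x) []) xs ≡ 0
  count-none []       = refl
  count-none (_ ∷ xs) = count-none xs
count-any {P = P} P? (y ∷ ys) xs = begin
  count (λ x → any? (λ z → P? z x) (y ∷ ys)) xs
    ≤⟨ count-mono (λ x → any? (λ z → P? z x) (y ∷ ys)) AnyRest? split xs ⟩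
  count AnyRest? xs
    ≤⟨ count-⊎ (P? y) (λ x → any? (λ z → P? z x) ys) xs ⟩
  count (P? y) xs + count (λ x → any? (λ z → P? z x) ys) xs
    ≤⟨ +-monoʳ-≤ (count (P? y) xs) (count-any P? ys xs) ⟩
  count (P? y) xs + ∑[ z ← ys ] (count (P? z) xs) ∎
  where
  open ≤-Reasoning
  AnyRest? : Decidable (λ x → P y x ⊎ Any (λ z → P z x) ys)
  AnyRest? = λ x → P? y x ⊎-dec any? (λ z → P? z x) ys
  split : ∀ x → Any (λ z → P z x) (y ∷ ys) → P y x ⊎ Any (λ z → P z x) ys
  split x (here p)  = inj₁ p
  split x (there p) = inj₂ p

chebyshev : (d : A → ℕ) (b c : ℕ) (xs : List A) →
            count (λ x → c <? b * d x) xs * (c * c) ≤ b * b * ∑[ x ← xs ] (d x * d x)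
chebyshev d b c xs = begin
  count (λ x → c <? b * d x) xs * (c * c)
    ≤⟨ markov (λ x → c <? b * d x) (λ x → b * b * (d x * d x)) (c * c) large xs ⟩
  ∑[ x ← xs ] (b * b * (d x * d x))
    ≡⟨ ∑-*ˡ (b * b) (λ x → d x * d x) xs ⟩
  b * b * ∑[ x ← xs ] (d x * d x) ∎
  where
  open ≤-Reasoning
  regroup : ∀ b d → (b * d) * (b * d) ≡ b * b * (d * d)
  regroup = solve-∀
  large : ∀ x → c < b * d x → c * c ≤ b * b * (d x * d x)
  large x c<bd = ≤-trans (*-mono-≤ (<⇒≤ c<bd) (<⇒≤ c<bd)) (≤-reflexive (regroup b (d x)))

select : {P : Pred A 0ℓ} → Decidable P → (xs : List A) → Subset (length xs)
select P? xs = Vec.tabulate (λ i → does (P? (lookup xs i)))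

module _ {P : Pred A 0ℓ} (P? : Decidable P) where

  ∣select∣ : (xs : List A) → ∣ select P? xs ∣ ≡ count P? xs
  ∣select∣ []       = refl
  ∣select∣ (x ∷ xs) with P? x
  ... | yes _ = cong suc (∣select∣ xs)
  ... | no  _ = ∣select∣ xs

  ∈-select : (xs : List A) (i : Fin (length xs)) → i ∈ select P? xs → P (lookup xs i)
  ∈-select xs i i∈ = invert (subst (Reflects (P (lookup xs i))) does≡true (proof (P? (lookup xs i))))
    where
    does≡true : does (P? (lookup xs i)) ≡ true
    does≡true = trans (sym (Vec.lookup∘tabulate (λ j → does (P? (lookup xs j))) i)) (Vec.[]=⇒lookup i∈)

DenselyMany : ℕ → (xs : List A) → Pred A 0ℓ → Set
DenselyMany k xs P = ∃[ S ] (k * length xs ≤ suc k * ∣ S ∣ × ((i : Fin (length xs)) → i ∈ S → P (lookup xs i)))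

rare⇒complement-denselyMany : {P : Pred A 0ℓ} (P? : Decidable P) (k : ℕ) (xs : List A) →
                              suc k * count P? xs ≤ length xs → DenselyMany k xs (¬_ ∘ P)
rare⇒complement-denselyMany P? k xs rare = select (¬? ∘ P?) xs , dense , ∈-select (¬? ∘ P?) xs
  where
  open ≤-Reasoning
  good : ℕ
  good = count (¬? ∘ P?) xs
  dense : k * length xs ≤ suc k * ∣ select (¬? ∘ P?) xs ∣
  dense rewrite ∣select∣ (¬? ∘ P?) xs = +-cancelʳ-≤ (length xs) (k * length xs) (suc k * good) (begin
    k * length xs + length xs          ≡⟨ +-comm (k * length xs) (length xs) ⟩
    suc k * length xs                  ≡⟨ cong (suc k *_) (sym (count-complement P? xs)) ⟩
    suc k * (count P? xs + good)       ≡⟨ *-distribˡ-+ (suc k) (count P? xs) good ⟩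
    suc k * count P? xs + suc k * good ≤⟨ +-monoˡ-≤ (suc k * good) rare ⟩
    length xs + suc k * good           ≡⟨ +-comm (length xs) (suc k * good) ⟩
    suc k * good + length xs           ∎)

denselyMany-mono : {P Q : Pred A 0ℓ} {k : ℕ} {xs : List A} → (∀ x → P x → Q x) → DenselyMany k xs P → DenselyMany k xs Q
denselyMany-mono P⇒Q (S , dense , P-on-S) = S , dense , λ i i∈S → P⇒Q _ (P-on-S i i∈S)

words : List A → ℕ → List (List A)
words letters zero    = [] ∷ []
words letters (suc L) = concatMap (λ a → map (a ∷_) (words letters L)) letters

length-words : (letters : List A) (L : ℕ) → length (words letters L) ≡ length letters ^ L
length-words letters zero    = refl
length-words letters (suc L) = begin
  length (concatMap (λ a → map (a ∷_) (words letters L)) letters)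
    ≡⟨ length-concatMap (λ a → map (a ∷_) (words letters L)) letters ⟩
  ∑[ a ← letters ] (length (map (a ∷_) (words letters L)))
    ≡⟨ ∑-cong (λ a → trans (length-map (a ∷_) (words letters L)) (length-words letters L)) letters ⟩
  ∑ letters (λ _ → length letters ^ L)
    ≡⟨ ∑-const (length letters ^ L) letters ⟩
  length letters * length letters ^ L ∎
  where open ≡-Reasoning

∈-words : {letters w : List A} → All (_∈ₗ letters) w → w ∈ₗ words letters (length w)
∈-words []                 = here refl
∈-words {letters = letters} {a ∷ w} (a∈ ∷ w∈) =
  ∈-concat⁺′ (∈-map⁺ (a ∷_) (∈-words w∈)) (∈-map⁺ (λ a′ → map (a′ ∷_) (words letters (length w))) a∈)

∈-mapMaybe⁺ : (f : A → Maybe B) {x : A} {y : B} {xs : List A} → x ∈ₗ xs → f x ≡ just y → y ∈ₗ mapMaybe f xs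
∈-mapMaybe⁺ f {y = y} {xs} x∈ fx≡y =
  Any.mapMaybe⁺ f xs (Any.map⁺ (Any.map (λ { refl → subst (MaybeAny.Any (y ≡_)) (sym fx≡y) (MaybeAny.just refl) }) x∈))

-- Agreements of random functions

agreements : {n : ℕ} → BoolFun n → BoolFun n → ℕ
agreements {n} f g = count (λ x → f x ≟ᵇ g x) (allInputs n)

agreements-comm : {n : ℕ} (f g : BoolFun n) → agreements f g ≡ agreements g f
agreements-comm {n} f g = cong length (filter-≐ (λ x → f x ≟ᵇ g x) (λ x → g x ≟ᵇ f x) (sym , sym) (allInputs n))

agreements-glue : {n : ℕ} (g h : BoolFun n) (G : BoolFun (suc n)) →
                  agreements (glue g h) G ≡ agreements g (G ∘ (false ∷_)) + agreements h (G ∘ (true ∷_))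
agreements-glue {n} g h G = begin
  count P? (map (false ∷_) (allInputs n) ++ map (true ∷_) (allInputs n))
    ≡⟨ count-++ P? (map (false ∷_) (allInputs n)) (map (true ∷_) (allInputs n)) ⟩
  count P? (map (false ∷_) (allInputs n)) + count P? (map (true ∷_) (allInputs n))
    ≡⟨ cong₂ _+_ (count-map P? (false ∷_) (allInputs n)) (count-map P? (true ∷_) (allInputs n)) ⟩
  agreements g (G ∘ (false ∷_)) + agreements h (G ∘ (true ∷_)) ∎
  where
  open ≡-Reasoning
  P? : Decidable (λ x → glue g h x ≡ G x)
  P? x = glue g h x ≟ᵇ G x

∑-allFuns-suc : (n : ℕ) (w : BoolFun (suc n) → ℕ) →
                ∑ (allFuns (suc n)) w ≡ ∑[ g ← allFuns n ] ∑[ h ← allFuns n ] (w (glue g h))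
∑-allFuns-suc n w = trans (∑-concatMap (λ g → map (glue g) (allFuns n)) w (allFuns n))
                          (∑-cong (λ g → ∑-map (glue g) w (allFuns n)) (allFuns n))

∑-allFuns-suc-agreements : (n : ℕ) (G : BoolFun (suc n)) (φ : ℕ → ℕ) →
  ∑[ f ← allFuns (suc n) ] (φ (agreements f G)) ≡
  ∑[ g ← allFuns n ] ∑[ h ← allFuns n ] (φ (agreements g (G ∘ (false ∷_)) + agreements h (G ∘ (true ∷_))))
∑-allFuns-suc-agreements n G φ = trans (∑-allFuns-suc n (φ ∘ (λ f → agreements f G)))
  (∑-cong (λ g → ∑-cong (λ h → cong φ (agreements-glue g h G)) (allFuns n)) (allFuns n))

length-allFuns-suc : (n : ℕ) → length (allFuns (suc n)) ≡ length (allFuns n) * length (allFuns n)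
length-allFuns-suc n = begin
  length (concatMap (λ g → map (glue g) (allFuns n)) (allFuns n))
    ≡⟨ length-concatMap (λ g → map (glue g) (allFuns n)) (allFuns n) ⟩
  ∑[ g ← allFuns n ] (length (map (glue g) (allFuns n)))
    ≡⟨ ∑-cong (λ g → length-map (glue g) (allFuns n)) (allFuns n) ⟩
  ∑ (allFuns n) (λ _ → length (allFuns n))
    ≡⟨ ∑-const (length (allFuns n)) (allFuns n) ⟩
  length (allFuns n) * length (allFuns n) ∎
  where open ≡-Reasoning

length-allFuns : (n : ℕ) → length (allFuns n) ≡ 2 ^ 2 ^ n
length-allFuns zero    = refl
length-allFuns (suc n) = begin
  length (allFuns (suc n))                  ≡⟨ length-allFuns-suc n ⟩
  length (allFuns n) * length (allFuns n)   ≡⟨ cong₂ _*_ (length-allFuns n) (length-allFuns n) ⟩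
  2 ^ 2 ^ n * 2 ^ 2 ^ n                     ≡⟨ sym (^-distribˡ-+-* 2 (2 ^ n) (2 ^ n)) ⟩
  2 ^ (2 ^ n + 2 ^ n)                       ≡⟨ cong (2 ^_) (sym (2^suc n)) ⟩
  2 ^ 2 ^ suc n                             ∎
  where open ≡-Reasoning

∑-3^agreements : (n : ℕ) (G : BoolFun n) → ∑[ f ← allFuns n ] (3 ^ agreements f G) ≡ 4 ^ 2 ^ n
∑-3^agreements zero G with G []
... | false = refl
... | true  = refl
∑-3^agreements (suc n) G = begin
  ∑[ f ← allFuns (suc n) ] (3 ^ agreements f G)
    ≡⟨ ∑-allFuns-suc-agreements n G (3 ^_) ⟩
  ∑[ g ← L ] ∑[ h ← L ] (3 ^ (a g + c h))
    ≡⟨ ∑-cong (λ g → ∑-cong (λ h → ^-distribˡ-+-* 3 (a g) (c h)) L) L ⟩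
  ∑[ g ← L ] ∑[ h ← L ] (3 ^ a g * 3 ^ c h)
    ≡⟨ ∑∑-* L L (λ g → 3 ^ a g) (λ h → 3 ^ c h) ⟩
  ∑[ g ← L ] (3 ^ a g) * ∑[ h ← L ] (3 ^ c h)
    ≡⟨ cong₂ _*_ (∑-3^agreements n (G ∘ (false ∷_))) (∑-3^agreements n (G ∘ (true ∷_))) ⟩
  4 ^ 2 ^ n * 4 ^ 2 ^ n
    ≡⟨ sym (^-distribˡ-+-* 4 (2 ^ n) (2 ^ n)) ⟩
  4 ^ (2 ^ n + 2 ^ n)
    ≡⟨ cong (4 ^_) (sym (2^suc n)) ⟩
  4 ^ 2 ^ suc n ∎
  where
  open ≡-Reasoning
  L : List (BoolFun n)
  L = allFuns n
  a c : BoolFun n → ℕ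
  a g = agreements g (G ∘ (false ∷_))
  c h = agreements h (G ∘ (true ∷_))

∑-agreements : (n : ℕ) (G : BoolFun n) → 2 * ∑[ f ← allFuns n ] (agreements f G) ≡ length (allFuns n) * 2 ^ n
∑-agreements zero G with G []
... | false = refl
... | true  = refl
∑-agreements (suc n) G = begin
  2 * ∑[ f ← allFuns (suc n) ] (agreements f G)
    ≡⟨ cong (2 *_) (∑-allFuns-suc-agreements n G (λ x → x)) ⟩
  2 * ∑[ g ← L ] ∑[ h ← L ] (a g + c h)
    ≡⟨ cong (2 *_) (∑∑-+ L L a c) ⟩
  2 * (N * ∑ L a + N * ∑ L c)
    ≡⟨ distribute N (∑ L a) (∑ L c) ⟩
  N * (2 * ∑ L a) + N * (2 * ∑ L c)
    ≡⟨ cong₂ (λ u v → N * u + N * v) (∑-agreements n (G ∘ (false ∷_))) (∑-agreements n (G ∘ (true ∷_))) ⟩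
  N * (N * 2 ^ n) + N * (N * 2 ^ n)
    ≡⟨ collect N (2 ^ n) ⟩
  (N * N) * (2 ^ n + 2 ^ n)
    ≡⟨ cong₂ _*_ (sym (length-allFuns-suc n)) (sym (2^suc n)) ⟩
  length (allFuns (suc n)) * 2 ^ suc n ∎
  where
  open ≡-Reasoning
  L : List (BoolFun n)
  L = allFuns n
  N : ℕ
  N = length L
  a c : BoolFun n → ℕ
  a g = agreements g (G ∘ (false ∷_))
  c h = agreements h (G ∘ (true ∷_))
  distribute : ∀ N x y → 2 * (N * x + N * y) ≡ N * (2 * x) + N * (2 * y)
  distribute = solve-∀
  collect : ∀ N m → N * (N * m) + N * (N * m) ≡ (N * N) * (m + m)
  collect = solve-∀

∑-agreements² : (n : ℕ) (G : BoolFun n) →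
  4 * ∑[ f ← allFuns n ] (agreements f G * agreements f G) ≡ length (allFuns n) * (2 ^ n * (2 ^ n + 1))
∑-agreements² zero G with G []
... | false = refl
... | true  = refl
∑-agreements² (suc n) G = begin
  4 * ∑[ f ← allFuns (suc n) ] (agreements f G * agreements f G)
    ≡⟨ cong (4 *_) (∑-allFuns-suc-agreements n G (λ x → x * x)) ⟩
  4 * ∑[ g ← L ] ∑[ h ← L ] ((a g + c h) * (a g + c h))
    ≡⟨ cong (4 *_) (∑∑-+² L L a c) ⟩
  4 * ((N * ∑[ g ← L ] (a g * a g) + N * ∑[ h ← L ] (c h * c h)) + 2 * (∑ L a * ∑ L c))
    ≡⟨ distribute N (∑[ g ← L ] (a g * a g)) (∑[ h ← L ] (c h * c h)) (∑ L a) (∑ L c) ⟩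
  (N * (4 * ∑[ g ← L ] (a g * a g)) + N * (4 * ∑[ h ← L ] (c h * c h))) + 2 * ((2 * ∑ L a) * (2 * ∑ L c))
    ≡⟨ cong₂ _+_ (cong₂ (λ u v → N * u + N * v) (∑-agreements² n G₀) (∑-agreements² n G₁))
                 (cong₂ (λ u v → 2 * (u * v)) (∑-agreements n G₀) (∑-agreements n G₁)) ⟩
  (N * (N * (m * (m + 1))) + N * (N * (m * (m + 1)))) + 2 * ((N * m) * (N * m))
    ≡⟨ collect N m ⟩
  (N * N) * ((m + m) * ((m + m) + 1))
    ≡⟨ cong₂ (λ u v → u * (v * (v + 1))) (sym (length-allFuns-suc n)) (sym (2^suc n)) ⟩
  length (allFuns (suc n)) * (2 ^ suc n * (2 ^ suc n + 1)) ∎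
  where
  open ≡-Reasoning
  L : List (BoolFun n)
  L = allFuns n
  N : ℕ
  N = length L
  m : ℕ
  m = 2 ^ n
  G₀ G₁ : BoolFun n
  G₀ = G ∘ (false ∷_)
  G₁ = G ∘ (true ∷_)
  a c : BoolFun n → ℕ
  a g = agreements g G₀
  c h = agreements h G₁
  distribute : ∀ N p q x y → 4 * ((N * p + N * q) + 2 * (x * y)) ≡ (N * (4 * p) + N * (4 * q)) + 2 * ((2 * x) * (2 * y))
  distribute = solve-∀
  collect : ∀ N m → (N * (N * (m * (m + 1))) + N * (N * (m * (m + 1)))) + 2 * ((N * m) * (N * m)) ≡
                    (N * N) * ((m + m) * ((m + m) + 1))
  collect = solve-∀

-- Balance

deviation : {n : ℕ} → BoolFun n → BoolFun n → ℕ
deviation {n} f g = ∣ 2 * agreements f g - 2 ^ n ∣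

∑-deviation² : (n : ℕ) (G : BoolFun n) →
               ∑[ f ← allFuns n ] (deviation f G * deviation f G) ≡ length (allFuns n) * 2 ^ n
∑-deviation² n G = +-cancelʳ-≡ (2 * (N * m) * m) _ _ (begin
  ∑[ f ← L ] (d f * d f) + 2 * (N * m) * m
    ≡⟨ cong (λ s → ∑[ f ← L ] (d f * d f) + 2 * s * m) (sym (∑-agreements n G)) ⟩
  ∑[ f ← L ] (d f * d f) + 2 * (2 * ∑ L a) * m
    ≡⟨ cong (∑[ f ← L ] (d f * d f) +_) (sym ∑-cross) ⟩
  ∑[ f ← L ] (d f * d f) + ∑[ f ← L ] (2 * (2 * a f) * m)
    ≡⟨ sym (∑-+ (λ f → d f * d f) (λ f → 2 * (2 * a f) * m) L) ⟩
  ∑[ f ← L ] (d f * d f + 2 * (2 * a f) * m)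
    ≡⟨ ∑-cong (λ f → ∣m-n∣²+2mn (2 * a f) m) L ⟩
  ∑[ f ← L ] ((2 * a f) * (2 * a f) + m * m)
    ≡⟨ ∑-+ (λ f → (2 * a f) * (2 * a f)) (λ _ → m * m) L ⟩
  ∑[ f ← L ] ((2 * a f) * (2 * a f)) + ∑ L (λ _ → m * m)
    ≡⟨ cong₂ _+_ ∑-square (∑-const (m * m) L) ⟩
  4 * ∑[ f ← L ] (a f * a f) + N * (m * m)
    ≡⟨ cong (_+ N * (m * m)) (∑-agreements² n G) ⟩
  N * (m * (m + 1)) + N * (m * m)
    ≡⟨ rearrange N m ⟩
  N * m + 2 * (N * m) * m ∎)
  where
  open ≡-Reasoning
  L : List (BoolFun n)
  L = allFuns n
  N : ℕ
  N = length L
  m : ℕ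
  m = 2 ^ n
  a d : BoolFun n → ℕ
  a f = agreements f G
  d f = deviation f G
  ∑-cross : ∑[ f ← L ] (2 * (2 * a f) * m) ≡ 2 * (2 * ∑ L a) * m
  ∑-cross = trans (∑-*ʳ m (λ f → 2 * (2 * a f)) L)
                  (cong (_* m) (trans (∑-*ˡ 2 (λ f → 2 * a f) L) (cong (2 *_) (∑-*ˡ 2 a L))))
  ∑-square : ∑[ f ← L ] ((2 * a f) * (2 * a f)) ≡ 4 * ∑[ f ← L ] (a f * a f)
  ∑-square = trans (∑-cong (λ f → double-square (a f)) L) (∑-*ˡ 4 (λ f → a f * a f) L)
    where
    double-square : ∀ x → (2 * x) * (2 * x) ≡ 4 * (x * x)
    double-square = solve-∀
  rearrange : ∀ N m → N * (m * (m + 1)) + N * (m * m) ≡ N * m + 2 * (N * m) * m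
  rearrange = solve-∀

Unbalanced : {n : ℕ} → ℕ → Bool → BoolFun n → Set
Unbalanced {n} b c f = 2 ^ n < b * deviation f (λ _ → c)

unbalanced? : {n : ℕ} (b : ℕ) (c : Bool) → Decidable (Unbalanced {n} b c)
unbalanced? {n} b c f = 2 ^ n <? b * deviation f (λ _ → c)

count-unbalanced : (n b d : ℕ) (c : Bool) → d * (b * b) ≤ 2 ^ n →
                   d * count (unbalanced? b c) (allFuns n) ≤ length (allFuns n)
count-unbalanced n b d c d*b²≤m = *-cancelʳ-≤ (d * U) N (m * m) {{m*n≢0 m m}} (begin
  d * U * (m * m)           ≡⟨ *-assoc d U (m * m) ⟩
  d * (U * (m * m))         ≤⟨ *-monoʳ-≤ d (chebyshev (λ f → deviation f (λ _ → c)) b m L) ⟩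
  d * (b * b * ∑[ f ← L ] (deviation f (λ _ → c) * deviation f (λ _ → c)))
                            ≡⟨ cong (λ s → d * (b * b * s)) (∑-deviation² n (λ _ → c)) ⟩
  d * (b * b * (N * m))     ≡⟨ sym (*-assoc d (b * b) (N * m)) ⟩
  d * (b * b) * (N * m)     ≤⟨ *-monoˡ-≤ (N * m) d*b²≤m ⟩
  m * (N * m)               ≡⟨ swap m N ⟩
  N * (m * m)               ∎)
  where
  open ≤-Reasoning
  L : List (BoolFun n)
  L = allFuns n
  N : ℕ
  N = length L
  m : ℕ
  m = 2 ^ n
  instance
    m≢0 : NonZero m
    m≢0 = m^n≢0 2 n
  U : ℕ
  U = count (unbalanced? b c) L
  swap : ∀ m N → m * (N * m) ≡ N * (m * m)
  swap = solve-∀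

¬unbalanced⇒balanced : ∀ {n} a b (f : BoolFun n) → 2 * a < b →
                       ¬ Unbalanced b false f → ¬ Unbalanced b true f → Balanced a b f
¬unbalanced⇒balanced {n} a b f 2a<b ¬unbalanced₀ ¬unbalanced₁ =
  let lower₀ , upper₀ = between false ¬unbalanced₀
      lower₁ , upper₁ = between true ¬unbalanced₁
  in lower₀ , upper₀ , lower₁ , upper₁
  where
  between : ∀ c → ¬ Unbalanced b c f →
            a * 2 ^ n ≤ b * preimageSize f c × b * preimageSize f c ≤ (b ∸ a) * 2 ^ n
  between c ¬unbalanced = small-deviation⇒between a b (2 ^ n) (preimageSize f c) 2a<b (≮⇒≥ ¬unbalanced)

-- Postfix encoding of formulas

-- skip is a no-op letter; it pads encodings of different lengths to a common word length.
data Token (n : ℕ) : Set where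
  skip conj disj : Token n
  leaf           : Fin n → Bool → Token n

tokens : (n : ℕ) → List (Token n)
tokens n = skip ∷ conj ∷ disj ∷ concatMap (λ i → leaf i false ∷ leaf i true ∷ []) (allFin n)

length-tokens : (n : ℕ) → length (tokens n) ≡ 3 + n * 2
length-tokens n = cong (3 +_) (begin
  length (concatMap (λ i → leaf i false ∷ leaf i true ∷ []) (allFin n))
    ≡⟨ length-concatMap (λ i → leaf i false ∷ leaf i true ∷ []) (allFin n) ⟩
  ∑ (allFin n) (λ _ → 2)
    ≡⟨ ∑-const 2 (allFin n) ⟩
  length (allFin n) * 2
    ≡⟨ cong (_* 2) (length-tabulate {n = n} (λ i → i)) ⟩
  n * 2 ∎)
  where open ≡-Reasoning

∈-tokens : {n : ℕ} (t : Token n) → t ∈ₗ tokens n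
∈-tokens skip       = here refl
∈-tokens conj       = there (here refl)
∈-tokens disj       = there (there (here refl))
∈-tokens (leaf i b) = there (there (there (∈-concat⁺′ (leaf∈ b) (∈-map⁺ _ (∈-allFin i)))))
  where
  leaf∈ : ∀ b → leaf i b ∈ₗ (leaf i false ∷ leaf i true ∷ [])
  leaf∈ false = here refl
  leaf∈ true  = there (here refl)

run : {n : ℕ} → List (Token n) → List (Formula n) → List (Formula n)
run []              stack           = stack
run (skip ∷ w)      stack           = run w stack
run (leaf i b ∷ w)  stack           = run w (lit i b ∷ stack)
run (conj ∷ w)      (G ∷ F ∷ stack) = run w (and F G ∷ stack)
run (disj ∷ w)      (G ∷ F ∷ stack) = run w (or F G ∷ stack)
run (_ ∷ _)         _               = []

encode : {n : ℕ} → Formula n → List (Token n)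
encode (lit i b) = [ leaf i b ]
encode (and F G) = encode F ++ encode G ++ [ conj ]
encode (or F G)  = encode F ++ encode G ++ [ disj ]

decode : {n : ℕ} → List (Token n) → Maybe (Formula n)
decode w = head (run w [])

run-encode : {n : ℕ} (F : Formula n) (w : List (Token n)) (stack : List (Formula n)) →
             run (encode F ++ w) stack ≡ run w (F ∷ stack)
run-encode-binary : {n : ℕ} (F G : Formula n) (t : Token n) (w : List (Token n)) (stack : List (Formula n)) →
                    run ((encode F ++ encode G ++ [ t ]) ++ w) stack ≡ run (t ∷ w) (G ∷ F ∷ stack)

run-encode (lit i b) w stack = refl
run-encode (and F G) w stack = run-encode-binary F G conj w stack
run-encode (or F G)  w stack = run-encode-binary F G disj w stack

run-encode-binary F G t w stack = begin
  run ((encode F ++ encode G ++ [ t ]) ++ w) stack ≡⟨ cong (λ v → run v stack) (++-assoc (encode F) _ w) ⟩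
  run (encode F ++ (encode G ++ [ t ]) ++ w) stack ≡⟨ run-encode F _ stack ⟩
  run ((encode G ++ [ t ]) ++ w) (F ∷ stack)       ≡⟨ cong (λ v → run v (F ∷ stack)) (++-assoc (encode G) [ t ] w) ⟩
  run (encode G ++ t ∷ w) (F ∷ stack)              ≡⟨ run-encode G (t ∷ w) (F ∷ stack) ⟩
  run (t ∷ w) (G ∷ F ∷ stack)                      ∎
  where open ≡-Reasoning

decode-padded : {n : ℕ} (r : ℕ) (F : Formula n) → decode (replicate r skip ++ encode F) ≡ just F
decode-padded zero    F = cong head (trans (cong (λ w → run w []) (sym (++-identityʳ (encode F)))) (run-encode F [] []))
decode-padded (suc r) F = decode-padded r F

length-encode : {n : ℕ} (F : Formula n) → length (encode F) < 2 * size F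
length-encode-binary : {n : ℕ} (F G : Formula n) (t : Token n) →
                       length (encode F ++ encode G ++ [ t ]) < 2 * (size F + size G)

length-encode (lit i b) = s≤s (s≤s z≤n)
length-encode (and F G) = length-encode-binary F G conj
length-encode (or F G)  = length-encode-binary F G disj

length-encode-binary F G t = begin-strict
  length (encode F ++ encode G ++ [ t ])         ≡⟨ length-++ (encode F) ⟩
  length (encode F) + length (encode G ++ [ t ]) ≡⟨ cong (length (encode F) +_) (length-++ (encode G)) ⟩
  length (encode F) + (length (encode G) + 1)    ≡⟨ cong (length (encode F) +_) (+-comm (length (encode G)) 1) ⟩
  length (encode F) + suc (length (encode G))    <⟨ +-mono-<-≤ (length-encode F) (length-encode G) ⟩
  2 * size F + 2 * size G                        ≡⟨ *-distribˡ-+ 2 (size F) (size G) ⟨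
  2 * (size F + size G)                          ∎
  where open ≤-Reasoning

formulas : (n L : ℕ) → List (Formula n)
formulas n L = mapMaybe decode (words (tokens n) L)

length-formulas : (n L : ℕ) → length (formulas n L) ≤ (3 + n * 2) ^ L
length-formulas n L = ≤-trans (length-mapMaybe decode (words (tokens n) L))
                              (≤-reflexive (trans (length-words (tokens n) L) (cong (_^ L) (length-tokens n))))

∈-formulas : {n : ℕ} (F : Formula n) (s : ℕ) → size F ≤ s → F ∈ₗ formulas n (2 * s)
∈-formulas {n} F s size≤s = ∈-mapMaybe⁺ decode padded∈ (decode-padded r F)
  where
  r : ℕ
  r = 2 * s ∸ length (encode F)
  padded : List (Token n)
  padded = replicate r skip ++ encode F
  length-padded : length padded ≡ 2 * s
  length-padded = begin
    length (replicate r skip ++ encode F)         ≡⟨ length-++ (replicate r skip) ⟩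
    length (replicate r skip) + length (encode F) ≡⟨ cong (_+ length (encode F)) (length-replicate r) ⟩
    r + length (encode F)                         ≡⟨ m∸n+n≡m (<⇒≤ (<-≤-trans (length-encode F) (*-monoʳ-≤ 2 size≤s))) ⟩
    2 * s                                         ∎
    where open ≡-Reasoning
  padded∈ : padded ∈ₗ words (tokens n) (2 * s)
  padded∈ = subst (λ L → padded ∈ₗ words (tokens n) L) length-padded (∈-words (All.tabulate (λ {t} _ → ∈-tokens t)))

Approximates : {n : ℕ} → Formula n → BoolFun n → Set
Approximates {n} F f = 3 * 2 ^ n ≤ 4 * agreement F f

approximates? : {n : ℕ} (F : Formula n) → Decidable (Approximates F)
approximates? {n} F f = 3 * 2 ^ n ≤? 4 * agreement F f

count-approximated : (n t : ℕ) (F : Formula n) → 4 * t ≤ 3 * 2 ^ n →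
                     count (approximates? F) (allFuns n) * 3 ^ t ≤ 4 ^ 2 ^ n
count-approximated n t F 4t≤3m = begin
  count (approximates? F) (allFuns n) * 3 ^ t
    ≤⟨ markov (approximates? F) (λ f → 3 ^ agreements f (eval F)) (3 ^ t) many-agreements (allFuns n) ⟩
  ∑[ f ← allFuns n ] (3 ^ agreements f (eval F))
    ≡⟨ ∑-3^agreements n (eval F) ⟩
  4 ^ 2 ^ n ∎
  where
  open ≤-Reasoning
  many-agreements : ∀ f → Approximates F f → 3 ^ t ≤ 3 ^ agreements f (eval F)
  many-agreements f approx = ^-monoʳ-≤ 3 (*-cancelˡ-≤ {t} {agreements f (eval F)} 4 (begin
    4 * t                           ≤⟨ 4t≤3m ⟩
    3 * 2 ^ n                       ≤⟨ approx ⟩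
    4 * agreements (eval F) f       ≡⟨ cong (4 *_) (agreements-comm (eval F) f) ⟩
    4 * agreements f (eval F)       ∎))

ApproximatedIn : {n : ℕ} → List (Formula n) → BoolFun n → Set
ApproximatedIn Fs f = Any (λ F → Approximates F f) Fs

approximatedIn? : {n : ℕ} (Fs : List (Formula n)) → Decidable (ApproximatedIn Fs)
approximatedIn? Fs f = any? (λ F → approximates? F f) Fs

count-approximatedIn : (n t : ℕ) (Fs : List (Formula n)) → 4 * t ≤ 3 * 2 ^ n →
                       count (approximatedIn? Fs) (allFuns n) * 3 ^ t ≤ length Fs * 4 ^ 2 ^ n
count-approximatedIn n t Fs 4t≤3m = begin
  count (approximatedIn? Fs) (allFuns n) * 3 ^ t
    ≤⟨ *-monoˡ-≤ (3 ^ t) (count-any approximates? Fs (allFuns n)) ⟩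
  ∑[ F ← Fs ] (count (approximates? F) (allFuns n)) * 3 ^ t
    ≡⟨ ∑-*ʳ (3 ^ t) (λ F → count (approximates? F) (allFuns n)) Fs ⟨
  ∑[ F ← Fs ] (count (approximates? F) (allFuns n) * 3 ^ t)
    ≤⟨ ∑-mono (λ F → count-approximated n t F 4t≤3m) Fs ⟩
  ∑ Fs (λ _ → 4 ^ 2 ^ n)
    ≡⟨ ∑-const (4 ^ 2 ^ n) Fs ⟩
  length Fs * 4 ^ 2 ^ n ∎
  where open ≤-Reasoning

¬approximatedIn⇒large : {n : ℕ} (s : ℕ) (f : BoolFun n) → ¬ ApproximatedIn (formulas n (2 * s)) f →
                        (F : Formula n) → Approximates F f → s < size F
¬approximatedIn⇒large s f ¬approximated F approx with size F ≤? s
... | yes size≤s = ⊥-elim (¬approximated (lose (∈-formulas F s size≤s) approx))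
... | no  size≰s = ≰⇒> size≰s

union-bound : ∀ k N U₀ U₁ H → 4 * suc k * U₀ ≤ N → 4 * suc k * U₁ ≤ N → 2 * suc k * H ≤ N →
              suc k * (U₀ + (U₁ + H)) ≤ N
union-bound k N U₀ U₁ H U₀≤ U₁≤ H≤ = *-cancelˡ-≤ 4 (begin
  4 * (suc k * (U₀ + (U₁ + H)))                          ≡⟨ distribute k U₀ U₁ H ⟩
  4 * suc k * U₀ + 4 * suc k * U₁ + 2 * (2 * suc k * H)  ≤⟨ +-mono-≤ (+-mono-≤ U₀≤ U₁≤) (*-monoʳ-≤ 2 H≤) ⟩
  N + N + 2 * N                                          ≡⟨ collect N ⟩
  4 * N                                                  ∎)
  where
  open ≤-Reasoning
  distribute : ∀ k U₀ U₁ H → 4 * (suc k * (U₀ + (U₁ + H))) ≡ 4 * suc k * U₀ + 4 * suc k * U₁ + 2 * (2 * suc k * H)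
  distribute = solve-∀
  collect : ∀ N → N + N + 2 * N ≡ 4 * N
  collect = solve-∀

few-approximated : ∀ c X H K → c ≤ 2 ^ K → X ≤ 2 ^ K → H * (3 ^ 12) ^ K ≤ X * (4 ^ 16) ^ K → c * H ≤ (2 ^ 16) ^ K
few-approximated c X H K c≤ X≤ counted = *-cancelʳ-≤ (c * H) ((2 ^ 16) ^ K) ((3 ^ 12) ^ K) {{m^n≢0 (3 ^ 12) K}} (begin
  c * H * (3 ^ 12) ^ K              ≡⟨ *-assoc c H _ ⟩
  c * (H * (3 ^ 12) ^ K)            ≤⟨ *-mono-≤ c≤ (≤-trans counted (*-monoˡ-≤ _ X≤)) ⟩
  2 ^ K * (2 ^ K * (4 ^ 16) ^ K)    ≡⟨ *-assoc (2 ^ K) (2 ^ K) _ ⟨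
  2 ^ K * 2 ^ K * (4 ^ 16) ^ K      ≡⟨ cong (_* (4 ^ 16) ^ K) (^-distribʳ-* 2 2 K) ⟨
  (2 * 2) ^ K * (4 ^ 16) ^ K        ≡⟨ ^-distribʳ-* (2 * 2) (4 ^ 16) K ⟨
  (2 * 2 * 4 ^ 16) ^ K              ≤⟨ ^-monoˡ-≤ K (toWitness {a? = 2 * 2 * 4 ^ 16 ≤? 2 ^ 16 * 3 ^ 12} tt) ⟩
  (2 ^ 16 * 3 ^ 12) ^ K             ≡⟨ ^-distribʳ-* (2 ^ 16) (3 ^ 12) K ⟩
  (2 ^ 16) ^ K * (3 ^ 12) ^ K       ∎)
  where open ≤-Reasoning

size-lower-bound : ∀ n K s z .{{_ : NonZero n}} → 2 ^ K < (n ^ 4) ^ suc s → suc s ≤ z → 2 ^ (16 * K) ≤ n ^ (64 * z)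
size-lower-bound n K s z 2ᴷ< s<z = begin
  2 ^ (16 * K)            ≡⟨ cong (2 ^_) (*-comm 16 K) ⟩
  2 ^ (K * 16)            ≡⟨ ^-*-assoc 2 K 16 ⟨
  (2 ^ K) ^ 16            ≤⟨ ^-monoˡ-≤ 16 (<⇒≤ 2ᴷ<) ⟩
  ((n ^ 4) ^ suc s) ^ 16  ≤⟨ ^-monoˡ-≤ 16 (^-monoʳ-≤ (n ^ 4) {{m^n≢0 n 4}} s<z) ⟩
  ((n ^ 4) ^ z) ^ 16      ≡⟨ ^-*-assoc (n ^ 4) z 16 ⟩
  (n ^ 4) ^ (z * 16)      ≡⟨ ^-*-assoc n 4 (z * 16) ⟩
  n ^ (4 * (z * 16))      ≡⟨ cong (n ^_) (regroup z) ⟩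
  n ^ (64 * z)            ∎
  where
  open ≤-Reasoning
  regroup : ∀ z → 4 * (z * 16) ≡ 64 * z
  regroup = solve-∀

2^[4+j]≡16*2^j : ∀ j → 2 ^ (4 + j) ≡ 16 * 2 ^ j
2^[4+j]≡16*2^j j = ^-distribˡ-+-* 2 4 j

few-short-formulas : ∀ j s → ((4 + j) ^ 4) ^ s ≤ 2 ^ 2 ^ j → length (formulas (4 + j) (2 * s)) ≤ 2 ^ 2 ^ j
few-short-formulas j s small = begin
  length (formulas n (2 * s)) ≤⟨ length-formulas n (2 * s) ⟩
  (3 + n * 2) ^ (2 * s)       ≤⟨ ^-monoˡ-≤ (2 * s) (≤-trans (m≤m+n (3 + n * 2) _) (≤-reflexive (sym (square j)))) ⟩
  (n ^ 2) ^ (2 * s)           ≡⟨ ^-*-assoc n 2 (2 * s) ⟩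
  n ^ (2 * (2 * s))           ≡⟨ cong (n ^_) (*-assoc 2 2 s) ⟨
  n ^ (4 * s)                 ≡⟨ ^-*-assoc n 4 s ⟨
  (n ^ 4) ^ s                 ≤⟨ small ⟩
  2 ^ 2 ^ j                   ∎
  where
  open ≤-Reasoning
  n : ℕ
  n = 4 + j
  square : ∀ j → (4 + j) * ((4 + j) * 1) ≡ (3 + (4 + j) * 2) + (5 + 6 * j + j * j)
  square = solve-∀

rarely-approximated : ∀ c j s → c ≤ 2 ^ 2 ^ j → ((4 + j) ^ 4) ^ s ≤ 2 ^ 2 ^ j →
  c * count (approximatedIn? (formulas (4 + j) (2 * s))) (allFuns (4 + j)) ≤ length (allFuns (4 + j))
rarely-approximated c j s c≤ small =
  subst (c * H ≤_) (sym length-allFuns≡)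
        (few-approximated c (length Fs) H K c≤ (few-short-formulas j s small) counted)
  where
  n : ℕ
  n = 4 + j
  K : ℕ
  K = 2 ^ j
  Fs : List (Formula n)
  Fs = formulas n (2 * s)
  H : ℕ
  H = count (approximatedIn? Fs) (allFuns n)
  4*12K≡3*16K : ∀ K → 4 * (12 * K) ≡ 3 * (16 * K)
  4*12K≡3*16K = solve-∀
  counted : H * (3 ^ 12) ^ K ≤ length Fs * (4 ^ 16) ^ K
  counted = subst₂ (λ u v → H * u ≤ length Fs * v)
                   (sym (^-*-assoc 3 12 K))
                   (trans (cong (4 ^_) (2^[4+j]≡16*2^j j)) (sym (^-*-assoc 4 16 K)))
                   (count-approximatedIn n (12 * K) Fs
                     (≤-reflexive (trans (4*12K≡3*16K K) (cong (3 *_) (sym (2^[4+j]≡16*2^j j))))))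
  length-allFuns≡ : length (allFuns n) ≡ (2 ^ 16) ^ K
  length-allFuns≡ = trans (length-allFuns n) (trans (cong (2 ^_) (2^[4+j]≡16*2^j j)) (sym (^-*-assoc 2 16 K)))

hard-unless-approximated : ∀ j s (f : BoolFun (4 + j)) → 2 ^ 2 ^ j < ((4 + j) ^ 4) ^ suc s →
                           ¬ ApproximatedIn (formulas (4 + j) (2 * s)) f → L34-LowerBound 1 64 f
hard-unless-approximated j s f 2ᴷ< ¬approximated F approx =
  subst (λ e → 2 ^ e ≤ (4 + j) ^ (64 * size F)) (sym (trans (*-identityˡ _) (2^[4+j]≡16*2^j j)))
        (size-lower-bound (4 + j) (2 ^ j) s (size F) 2ᴷ< (¬approximatedIn⇒large s f ¬approximated F approx))

2[1+k]≤2^2^j : ∀ b k j .{{_ : NonZero b}} → 4 * suc k * (b * b) ≤ j → 2 * suc k ≤ 2 ^ 2 ^ j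
2[1+k]≤2^2^j b k j large = begin
  2 * suc k           ≤⟨ *-monoˡ-≤ (suc k) {2} {4} (s≤s (s≤s z≤n)) ⟩
  4 * suc k           ≤⟨ m≤m*n (4 * suc k) (b * b) {{m*n≢0 b b}} ⟩
  4 * suc k * (b * b) ≤⟨ large ⟩
  j                   <⟨ n<2^n j ⟩
  2 ^ j               <⟨ n<2^n (2 ^ j) ⟩
  2 ^ 2 ^ j           ∎
  where open ≤-Reasoning

denselyMany-balanced-hard : ∀ a b k j → 2 * a < b → 4 * suc k * (b * b) ≤ j →
  DenselyMany k (allFuns (4 + j)) (λ f → Balanced a b f × L34-LowerBound 1 64 f)
denselyMany-balanced-hard a b k j 2a<b large =
  denselyMany-mono {k = k} {xs = L} ¬bad⇒balanced-hard (rare⇒complement-denselyMany bad? k L bad-rare)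
  where
  n : ℕ
  n = 4 + j
  L : List (BoolFun n)
  L = allFuns n
  instance
    b≢0 : NonZero b
    b≢0 = >-nonZero (<-≤-trans z<s 2a<b)
  -- s ≈ 2ⁿ / (64 log₂ n): formulas of size ≤ s are few enough to be ruled out by counting.
  threshold : ∃[ s ] ((n ^ 4) ^ s ≤ 2 ^ 2 ^ j × 2 ^ 2 ^ j < (n ^ 4) ^ suc s)
  threshold = ∃-power-bracketing (n ^ 4) (2 ^ 2 ^ j) (≤-trans (s≤s (s≤s z≤n)) (^-monoʳ-≤ n {1} {4} (s≤s z≤n))) (m^n>0 2 (2 ^ j))
  s : ℕ
  s = proj₁ threshold
  Fs : List (Formula n)
  Fs = formulas n (2 * s)
  Bad : BoolFun n → Set
  Bad f = Unbalanced b false f ⊎ Unbalanced b true f ⊎ ApproximatedIn Fs f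
  bad? : Decidable Bad
  bad? f = unbalanced? b false f ⊎-dec (unbalanced? b true f ⊎-dec approximatedIn? Fs f)
  ¬bad⇒balanced-hard : ∀ f → ¬ Bad f → Balanced a b f × L34-LowerBound 1 64 f
  ¬bad⇒balanced-hard f ¬bad =
    ¬unbalanced⇒balanced a b f 2a<b (¬bad ∘ inj₁) (¬bad ∘ inj₂ ∘ inj₁) ,
    hard-unless-approximated j s f (proj₂ (proj₂ threshold)) (¬bad ∘ inj₂ ∘ inj₂)
  4[1+k]b²≤2ⁿ : 4 * suc k * (b * b) ≤ 2 ^ n
  4[1+k]b²≤2ⁿ = ≤-trans large (≤-trans (m≤n+m j 4) (<⇒≤ (n<2^n n)))
  bad-rare : suc k * count bad? L ≤ length L
  bad-rare = ≤-trans
    (*-monoʳ-≤ (suc k) (≤-trans (count-⊎ (unbalanced? b false) _ L)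
                                (+-monoʳ-≤ _ (count-⊎ (unbalanced? b true) (approximatedIn? Fs) L))))
    (union-bound k (length L) _ _ _
      (count-unbalanced n b (4 * suc k) false 4[1+k]b²≤2ⁿ)
      (count-unbalanced n b (4 * suc k) true 4[1+k]b²≤2ⁿ)
      (rarely-approximated (2 * suc k) j s (2[1+k]≤2^2^j b k j large) (proj₁ (proj₂ threshold))))

lemma9 : (a b : ℕ) → 3 * b < 8 * a → 2 * a < b →
    ∃[ p ] ∃[ q ] (0 < p × 0 < q ×
      ((k : ℕ) → ∃[ N ] ((n : ℕ) → N ≤ n →
        ∃[ S ] (k * length (allFuns n) ≤ suc k * ∣ S ∣ ×
          ((i : _) → i ∈ S →
            Balanced a b (lookup (allFuns n) i) × L34-LowerBound p q (lookup (allFuns n) i))))))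
lemma9 a b _ 2a<b = 1 , 64 , z<s , z<s , λ k → 4 + 4 * suc k * (b * b) , λ n N≤n →
  subst (λ n → DenselyMany k (allFuns n) (λ f → Balanced a b f × L34-LowerBound 1 64 f))
        (m+[n∸m]≡n (m+n≤o⇒m≤o 4 N≤n))
        (denselyMany-balanced-hard a b k (n ∸ 4) 2a<b (∸-monoˡ-≤ 4 N≤n))
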